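{- Let $G=(V_G,E_G)$ and $H=(V_H,E_H)$ be finite simple connected graphs with $V_G=\{x_1,\ldots,x_n\}$, $n\ge2$, $|V_H|\ge2$, and suppose $G$ is Hamilton-connected. Then, identifying the vertex $(y_1,\ldots,y_n)x$ of $G\wr H$ with $(y_1,\ldots,y_n,x)$, $$A(G\wr H)=A(H)^{\times n}\times O_n\qquad\text{and}\qquad diam(G\wr H)=n\,(diam(H)+1).$$
   Context: The wreath product $G\wr H$ has vertex set $\{(f,v): f:V_G\to V_H,\ v\in V_G\}$; $(f,v)$ and $(f',v')$ are adjacent iff either $v=v'$, $f(w)=f'(w)$ for $w\neq v$ and $f(v)\sim f'(v)$ in $H$, or $f=f'$ and $v\sim v'$ in $G$; the vertex $(f,x_i)$ is written $(y_1,\ldots,y_n)x_i$ with $y_j=f(x_j)$. $G$ is Hamilton-connected if for every pair of distinct vertices there is a path between them visiting every vertex exactly once. For a connected graph $X$, the antipodal graph $A(X)$ has vertex set $V_X$, with $u\sim v$ iff $d_X(u,v)=diam(X)$. $O_n$ is the graph on vertex set $V_G$ whose only edges are one loop at each vertex. The direct product $X\times Y$ (loops allowed) has vertex set $V_X\times V_Y$ with $(a,b)\sim(a',b')$ iff $a\sim a'$ and $b\sim b'$; $X^{\times n}$ is the $n$-fold direct power. -}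

module Defs where

open import Data.Nat using (ℕ; zero; suc; _≤_)
open import Data.Fin using (Fin)
open import Data.Vec using (Vec; lookup)
open import Data.List using (List; []; _∷_)
open import Data.List.Membership.Propositional using (_∈_)
open import Data.List.Relation.Unary.Unique.Propositional using (Unique)
open import Data.Product using (Σ; _×_; _,_; ∃)
open import Data.Sum using (_⊎_; inj₁; inj₂)
open import Relation.Nullary using (¬_)
open import Relation.Binary.PropositionalEquality using (_≡_; _≢_; refl; sym; trans; subst)

record Graph (V : Set) : Set₁ where
  field
    Adj    : V → V → Set
    adj-sym    : ∀ {u v} → Adj u v → Adj v u
    adj-irrefl : ∀ {u} → ¬ Adj u u
open Graph public

data Walk {V : Set} (G : Graph V) : V → V → ℕ → Set where
  here : ∀ {u} → Walk G u u zero
  step : ∀ {u w v k} → Adj G u w → Walk G w v k → Walk G u v (suc k)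

Connected : {V : Set} → Graph V → Set
Connected {V} G = (u v : V) → ∃ λ k → Walk G u v k

Dist : {V : Set} → Graph V → V → V → ℕ → Set
Dist G u v k = Walk G u v k × (∀ j → Walk G u v j → k ≤ j)

Diam : {V : Set} → Graph V → ℕ → Set
Diam {V} G D = (Σ V λ u → Σ V λ v → Dist G u v D)
             × (∀ u v k → Dist G u v k → k ≤ D)

data IsWalkList {V : Set} (G : Graph V) : V → List V → V → Set where
  single : ∀ {u} → IsWalkList G u (u ∷ []) u
  cons   : ∀ {u w v xs} → Adj G u w → IsWalkList G w xs v → IsWalkList G u (u ∷ xs) v

HamiltonConnected : {V : Set} → Graph V → Set
HamiltonConnected {V} G =
  (u v : V) → u ≢ v →
  Σ (List V) λ p → IsWalkList G u p v × Unique p × (∀ w → w ∈ p)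

Antipodal : {V : Set} → Graph V → V → V → Set
Antipodal G u v = Σ ℕ λ D → Diam G D × Dist G u v D

-- Wreath product G ≀ H; vertex (f , x) with f = (y_1,…,y_n) = (f(x_1),…,f(x_n)).
WAdj : ∀ {n m} → Graph (Fin n) → Graph (Fin m) →
       (Vec (Fin m) n × Fin n) → (Vec (Fin m) n × Fin n) → Set
WAdj G H (f , v) (f' , v') =
    (v ≡ v' × (∀ w → w ≢ v → lookup f w ≡ lookup f' w) × Adj H (lookup f v) (lookup f' v))
  ⊎ (f ≡ f' × Adj G v v')

private
  wsym : ∀ {n m} (G : Graph (Fin n)) (H : Graph (Fin m)) {a b} → WAdj G H a b → WAdj G H b a
  wsym G H {f , v} {f' , .v} (inj₁ (refl , e , a)) = inj₁ (refl , (λ w nw → sym (e w nw)) , adj-sym H a)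
  wsym G H (inj₂ (refl , a)) = inj₂ (refl , adj-sym G a)

  wirr : ∀ {n m} (G : Graph (Fin n)) (H : Graph (Fin m)) {a} → ¬ WAdj G H a a
  wirr G H (inj₁ (_ , _ , a)) = adj-irrefl H a
  wirr G H (inj₂ (_ , a)) = adj-irrefl G a

_≀_ : ∀ {n m} → Graph (Fin n) → Graph (Fin m) → Graph (Vec (Fin m) n × Fin n)
G ≀ H = record { Adj = WAdj G H ; adj-sym = wsym G H ; adj-irrefl = wirr G H }

-- Direct product of adjacency relations (loops allowed)
DirProd : {A B : Set} → (A → A → Set) → (B → B → Set) → (A × B) → (A × B) → Set
DirProd R S (a , b) (a' , b') = R a a' × S b b'

DirPow : {A : Set} → (A → A → Set) → (n : ℕ) → Vec A n → Vec A n → Set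
DirPow R n y y' = ∀ i → R (lookup y i) (lookup y' i)

O : (n : ℕ) → Fin n → Fin n → Set
O n x x' = x ≡ x'

-- A walk in G ≀ H from (f , x) to (f′ , v) must, for every coordinate w with f w ≠ f′ w,
-- stand at w and spend at least d_H (f w) (f′ w) moves there; if moreover x = v and every
-- coordinate differs, its moves in G form a closed walk through all n ≥ 2 vertices, hence
-- number at least n.  Conversely, following a Hamilton path (for x = v: one to a neighbour
-- of x, then back) and fixing each coordinate on the way gives a walk of length at most
-- n + Σ_w d_H (f w) (f′ w), and one shorter than that when x ≠ v.  So the diameter is
-- n (diam H + 1), and it is attained exactly when x = v and every coordinate pair is
-- antipodal in H.

module Submission where

open import Defs
open import Data.Nat using (ℕ; zero; suc; _*_; _≤_; _+_; _<_; z≤n; s≤s; _≤?_)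
open import Data.Nat.Properties
  using (+-0-commutativeMonoid; ≤-trans; ≤-antisym; ≤-reflexive; ≮⇒≥; <⇒≱; n≤1+n; m≤m+n; 1+n≰n; ≤-pred;
         +-identityʳ; *-zeroʳ; +-comm; +-assoc; +-suc; +-mono-≤; +-monoˡ-≤; +-monoʳ-≤; +-cancelˡ-≤;
         +-cancelʳ-≡; *-suc; module ≤-Reasoning)
open import Data.Nat.Induction using (<-rec)
open import Data.Fin using (Fin; zero; suc; punchIn) renaming (_≟_ to _≟ᶠ_)
open import Data.Fin.Properties using (pigeonhole; punchInᵢ≢i; ∀-cons) renaming (<⇒≢ to <ᶠ⇒≢)
open import Data.Vec using (Vec; lookup; _[_]≔_; replicate)
open import Data.Vec.Properties
  using (lookup∘update; lookup∘update′; []≔-lookup; []≔-idempotent; lookup-replicate;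
         tabulate∘lookup; tabulate-cong)
open import Data.Vec.Functional using (Vector; updateAt; removeAt)
open import Data.Vec.Functional.Properties using (updateAt-updates; updateAt-minimal)
open import Algebra.Properties.CommutativeMonoid.Sum +-0-commutativeMonoid using (sum; sum-remove; sum-cong-≗)
open import Data.List as List using (List; []; _∷_; length; allFin; cartesianProduct)
open import Data.List.Membership.Propositional using (_∈_; _∉_)
open import Data.List.Membership.Propositional.Properties using (∈-lookup; ∈-allFin; ∈-cartesianProduct⁺)
open import Data.List.Membership.Setoid.Properties using (index-injective)
open import Data.List.Relation.Unary.Any using (here; there; index)
open import Data.List.Relation.Unary.All as All using ()
open import Data.List.Relation.Unary.AllPairs using (_∷_)
open import Data.List.Relation.Unary.Unique.Propositional using (Unique)
open import Data.List.Extrema.Nat using (argmax; f[xs]≤f[argmax])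
open import Data.Product using (Σ; _×_; _,_; ∃; proj₁; proj₂; uncurry)
open import Data.Sum using (inj₁; inj₂)
open import Data.Empty using (⊥-elim)
open import Effect.Monad using (RawMonad)
open import Level using (0ℓ)
open import Function using (_∘_; const)
open import Function.Bundles using (_⇔_; mk⇔)
open import Relation.Nullary using (¬_; Dec; yes; no)
open import Relation.Nullary.Decidable using (decidable-stable; ¬¬-excluded-middle)
open import Relation.Nullary.Negation using (¬¬-Monad; ¬¬-map)
open import Relation.Binary.PropositionalEquality
  using (_≡_; _≢_; refl; sym; trans; cong; cong₂; subst; subst₂; setoid; module ≡-Reasoning)

open RawMonad (¬¬-Monad {0ℓ}) using (_>>=_; pure)

sum-const : ∀ n c → sum {n} (const c) ≡ n * c
sum-const zero    c = refl
sum-const (suc n) c = cong (c +_) (sum-const n c)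

n+sum-const : ∀ n c → n + sum {n} (const c) ≡ n * suc c
n+sum-const n c = trans (cong (n +_) (sum-const n c)) (sym (*-suc n c))

sum-mono-≤ : ∀ {n} {t t′ : Vector ℕ n} → (∀ i → t i ≤ t′ i) → sum t ≤ sum t′
sum-mono-≤ {zero}  t≤t′ = z≤n
sum-mono-≤ {suc _} t≤t′ = +-mono-≤ (t≤t′ zero) (sum-mono-≤ (t≤t′ ∘ suc))

≤-sum : ∀ {n} (t : Vector ℕ n) i → t i ≤ sum t
≤-sum {suc _} t i = subst (t i ≤_) (sym (sum-remove t)) (m≤m+n (t i) _)

sum-updateAt : ∀ {n} (t : Vector ℕ n) i (f : ℕ → ℕ) → sum (updateAt t i f) + t i ≡ sum t + f (t i)
sum-updateAt {suc _} t i f = begin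
  sum t′ + t i                        ≡⟨ cong (_+ t i) (sum-remove t′) ⟩
  (t′ i + sum (removeAt t′ i)) + t i  ≡⟨ cong₂ (λ a b → (a + b) + t i) (updateAt-updates i t) removed-agree ⟩
  (f (t i) + r) + t i                 ≡⟨ +-comm (f (t i) + r) (t i) ⟩
  t i + (f (t i) + r)                 ≡⟨ cong (t i +_) (+-comm (f (t i)) r) ⟩
  t i + (r + f (t i))                 ≡⟨ +-assoc (t i) r (f (t i)) ⟨
  (t i + r) + f (t i)                 ≡⟨ cong (_+ f (t i)) (sum-remove t) ⟨
  sum t + f (t i)                     ∎
  where
  open ≡-Reasoning
  t′ : Vector ℕ _
  t′ = updateAt t i f
  r : ℕ
  r = sum (removeAt t i)
  removed-agree : sum (removeAt t′ i) ≡ r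
  removed-agree = sum-cong-≗ (λ j → updateAt-minimal (punchIn i j) i t (punchInᵢ≢i i j))

sum-updateAt-suc : ∀ {n} (t : Vector ℕ n) i → sum (updateAt t i suc) ≡ suc (sum t)
sum-updateAt-suc t i = +-cancelʳ-≡ (t i) _ _ (trans (sum-updateAt t i suc) (+-suc (sum t) (t i)))

pointwise≤∧sum≥⇒≡ : ∀ {n} {t t′ : Vector ℕ n} → (∀ i → t i ≤ t′ i) → sum t′ ≤ sum t → ∀ i → t i ≡ t′ i
pointwise≤∧sum≥⇒≡ {t = t} {t′} t≤t′ Σt′≤Σt i = ≤-antisym (t≤t′ i) (+-cancelˡ-≤ (sum t) _ _ (begin
  sum t + t′ i  ≡⟨ sum-updateAt t i (const (t′ i)) ⟨
  sum s + t i   ≤⟨ +-monoˡ-≤ (t i) (≤-trans (sum-mono-≤ s≤t′) Σt′≤Σt) ⟩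
  sum t + t i   ∎))
  where
  open ≤-Reasoning
  s : Vector ℕ _
  s = updateAt t i (const (t′ i))
  s≤t′ : ∀ j → s j ≤ t′ j
  s≤t′ j with j ≟ᶠ i
  ... | yes refl = ≤-reflexive (updateAt-updates i t)
  ... | no j≢i   = subst (_≤ t′ j) (sym (updateAt-minimal j i t j≢i)) (t≤t′ j)

another : ∀ {k} → 2 ≤ k → (v : Fin k) → ∃ λ w → w ≢ v
another {suc zero}    (s≤s ()) _
another {suc (suc _)} _ v = punchIn v zero , punchInᵢ≢i v zero

two-vertices : ∀ {k} → 2 ≤ k → Σ (Fin k) λ a → Σ (Fin k) λ b → a ≢ b
two-vertices {suc zero}    (s≤s ())
two-vertices {suc (suc _)} _ = zero , suc zero , λ ()

unique⇒lookup-injective : ∀ {A : Set} {xs : List A} → Unique xs →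
  ∀ i j → List.lookup xs i ≡ List.lookup xs j → i ≡ j
unique⇒lookup-injective (_ ∷ _)     zero    zero    _  = refl
unique⇒lookup-injective (x∉xs ∷ _)  zero    (suc j) eq = ⊥-elim (All.lookup x∉xs (∈-lookup j) eq)
unique⇒lookup-injective (x∉xs ∷ _)  (suc i) zero    eq = ⊥-elim (All.lookup x∉xs (∈-lookup i) (sym eq))
unique⇒lookup-injective (_ ∷ uxs)   (suc i) (suc j) eq = cong suc (unique⇒lookup-injective uxs i j eq)

unique⇒length≤ : ∀ {k} {xs : List (Fin k)} → Unique xs → length xs ≤ k
unique⇒length≤ {xs = xs} uxs = ≮⇒≥ λ k<len →
  let i , j , i<j , eq = pigeonhole k<len (List.lookup xs)
  in <ᶠ⇒≢ i<j (unique⇒lookup-injective uxs i j eq)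

spanning⇒length≥ : ∀ {k} {xs : List (Fin k)} → (∀ w → w ∈ xs) → k ≤ length xs
spanning⇒length≥ spans = ≮⇒≥ λ len<k →
  let i , j , i<j , eq = pigeonhole len<k (index ∘ spans)
  in <ᶠ⇒≢ i<j (index-injective (setoid _) (spans i) (spans j) eq)

¬¬-least : ∀ {P : ℕ → Set} k → P k → ¬ ¬ (∃ λ j → P j × ∀ i → P i → j ≤ i)
¬¬-least {P} = <-rec _ λ k smaller pk → ¬¬-excluded-middle {A = ∃ λ i → i < k × P i} >>= λ where
  (yes (i , i<k , pi)) → smaller i<k pi
  (no ∄smaller)        → pure (k , pk , λ i pi → ≮⇒≥ λ i<k → ∄smaller (i , i<k , pi))

¬¬-Π : ∀ {k} {P : Fin k → Set} → (∀ i → ¬ ¬ P i) → ¬ ¬ (∀ i → P i)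
¬¬-Π {zero}  _  = pure λ ()
¬¬-Π {suc _} ¬¬p = ¬¬p zero >>= λ p₀ → ¬¬-Π (¬¬p ∘ suc) >>= λ pₛ → pure (∀-cons p₀ pₛ)

module _ {V : Set} {X : Graph V} where

  _++ᵂ_ : ∀ {a b c k j} → Walk X a b k → Walk X b c j → Walk X a c (k + j)
  here     ++ᵂ q = q
  step e p ++ᵂ q = step e (p ++ᵂ q)

  walk-length-pos : ∀ {a b k} → Walk X a b k → a ≢ b → 1 ≤ k
  walk-length-pos here       a≢b = ⊥-elim (a≢b refl)
  walk-length-pos (step _ _) _   = s≤s z≤n

  Dist-pos⇒≢ : ∀ {a b k} → Dist X a b k → 1 ≤ k → a ≢ b
  Dist-pos⇒≢ (_ , minimal) 1≤k refl = <⇒≱ 1≤k (minimal 0 here)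

  Dist-unique : ∀ {a b k j} → Dist X a b k → Dist X a b j → k ≡ j
  Dist-unique (Wk , mk) (Wj , mj) = ≤-antisym (mk _ Wj) (mj _ Wk)

  Diam-unique : ∀ {D D′} → Diam X D → Diam X D′ → D ≡ D′
  Diam-unique ((a , b , dist) , bounded) ((a′ , b′ , dist′) , bounded′) =
    ≤-antisym (bounded′ a b _ dist) (bounded a′ b′ _ dist′)

  adj⇒≢ : ∀ {u v} → Adj X u v → u ≢ v
  adj⇒≢ u~v refl = adj-irrefl X u~v

  first∈ : ∀ {u p v} → IsWalkList X u p v → u ∈ p
  first∈ single     = here refl
  first∈ (cons _ _) = here refl

  last∈ : ∀ {u p v} → IsWalkList X u p v → v ∈ p
  last∈ single        = here refl
  last∈ (cons _ rest) = there (last∈ rest)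

module _ {k : ℕ} {X : Graph (Fin k)} where

  has-neighbour : Connected X → 2 ≤ k → ∀ u → ∃ (Adj X u)
  has-neighbour conn 2≤k u = let w , w≢u = another 2≤k u in first-step (proj₂ (conn u w)) w≢u
    where
    first-step : ∀ {w j} → Walk X u w j → w ≢ u → ∃ (Adj X u)
    first-step here         w≢u = ⊥-elim (w≢u refl)
    first-step (step u~y _) _   = _ , u~y

  closed-spanning-length : 2 ≤ k → ∀ {x p} → IsWalkList X x p x → (∀ w → w ∈ p) → suc k ≤ length p
  closed-spanning-length 2≤k {x} single spans =
    let w , w≢x = another 2≤k x in ⊥-elim (w≢x (case-single (spans w)))
    where
    case-single : ∀ {w} → w ∈ x ∷ [] → w ≡ x
    case-single (here w≡x) = w≡x
  closed-spanning-length _ (cons {xs = xs} _ rest) spans = s≤s (spanning⇒length≥ spans-tail)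
    where
    spans-tail : ∀ w → w ∈ xs
    spans-tail w with spans w
    ... | here refl  = last∈ rest
    ... | there w∈xs = w∈xs

record DistanceTable {k : ℕ} (X : Graph (Fin k)) : Set where
  field
    δ      : Fin k → Fin k → ℕ
    δ-dist : ∀ a b → Dist X a b (δ a b)

  δ-min : ∀ {a b j} → Walk X a b j → δ a b ≤ j
  δ-min = proj₂ (δ-dist _ _) _

  diameter : Fin k → Σ ℕ (Diam X)
  diameter a₀ = δ′ farthest , (proj₁ farthest , proj₂ farthest , δ-dist _ _) , bounded
    where
    δ′ : Fin k × Fin k → ℕ
    δ′ = uncurry δ
    pairs : List (Fin k × Fin k)
    pairs = cartesianProduct (allFin k) (allFin k)
    farthest : Fin k × Fin k
    farthest = argmax δ′ (a₀ , a₀) pairs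
    bounded : ∀ a b j → Dist X a b j → j ≤ δ′ farthest
    bounded a b j dist = subst (_≤ δ′ farthest) (Dist-unique (δ-dist a b) dist)
      (All.lookup (f[xs]≤f[argmax] (a₀ , a₀) pairs) (∈-cartesianProduct⁺ (∈-allFin a) (∈-allFin b)))

¬¬-distanceTable : ∀ {k} {X : Graph (Fin k)} → Connected X → ¬ ¬ DistanceTable X
¬¬-distanceTable {X = X} conn = ¬¬-map table (¬¬-Π λ a → ¬¬-Π λ b → uncurry ¬¬-least (conn a b))
  where
  table : (∀ a b → Σ ℕ (Dist X a b)) → DistanceTable X
  table t = record { δ = λ a b → proj₁ (t a b) ; δ-dist = λ a b → proj₂ (t a b) }

vec-ext : ∀ {A : Set} {k} {xs ys : Vec A k} → (∀ i → lookup xs i ≡ lookup ys i) → xs ≡ ys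
vec-ext {xs = xs} {ys} eq = trans (sym (tabulate∘lookup xs)) (trans (tabulate-cong eq) (tabulate∘lookup ys))

module Wreath {n m} (G : Graph (Fin n)) (H : Graph (Fin m)) where

  Config : Set
  Config = Vec (Fin m) n

  lift-H-walk : ∀ (g : Config) x {a b k} → lookup g x ≡ a → Walk H a b k →
    Walk (G ≀ H) (g , x) (g [ x ]≔ b , x) k
  lift-H-walk g x refl here = subst (λ h → Walk (G ≀ H) (g , x) (h , x) 0) (sym ([]≔-lookup g x)) here
  lift-H-walk g x refl (step {w = a₁} a~a₁ rest) =
    step H-move (subst (λ h → Walk (G ≀ H) (g [ x ]≔ a₁ , x) (h , x) _) ([]≔-idempotent g x)
      (lift-H-walk (g [ x ]≔ a₁) x (lookup∘update x g a₁) rest))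
    where
    H-move : WAdj G H (g , x) (g [ x ]≔ a₁ , x)
    H-move = inj₁ (refl , (λ w w≢x → sym (lookup∘update′ w≢x g a₁))
                 , subst (Adj H (lookup g x)) (sym (lookup∘update x g a₁)) a~a₁)

  lookup-fix : ∀ (g f′ : Config) x w → (w ≢ x → lookup g w ≡ lookup f′ w) →
    lookup (g [ x ]≔ lookup f′ x) w ≡ lookup f′ w
  lookup-fix g f′ x w off with w ≟ᶠ x
  ... | yes refl = lookup∘update x g _
  ... | no w≢x   = trans (lookup∘update′ w≢x g _) (off w≢x)

  -- At each vertex of p the coordinate there is driven to its target by its H-walk, whose
  -- cost is then reset to 0.
  tour : ∀ {f′ x y p} {g : Config} → IsWalkList G x p y → (∀ w → w ∉ p → lookup g w ≡ lookup f′ w) →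
    (c : Vector ℕ n) → (∀ w → Walk H (lookup g w) (lookup f′ w) (c w)) →
    ∃ λ L → Walk (G ≀ H) (g , x) (f′ , y) L × suc L ≤ length p + sum c
  tour {f′} {x} {g = g} single off c hw =
    c x , subst (λ h → Walk (G ≀ H) (g , x) (h , x) (c x)) fixed (lift-H-walk g x refl (hw x)) ,
    s≤s (≤-sum c x)
    where
    fixed : g [ x ]≔ lookup f′ x ≡ f′
    fixed = vec-ext λ w → lookup-fix g f′ x w λ w≢x → off w λ { (here w≡x) → w≢x w≡x }
  tour {f′} {x} {y} {g = g} (cons {w = x₂} {xs = xs} x~x₂ rest) off c hw =
    c x + suc L , lift-H-walk g x refl (hw x) ++ᵂ step (inj₂ (refl , x~x₂)) W , bound
    where
    g′ : Config
    g′ = g [ x ]≔ lookup f′ x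
    c′ : Vector ℕ n
    c′ = updateAt c x (const 0)
    hw′ : ∀ w → Walk H (lookup g′ w) (lookup f′ w) (c′ w)
    hw′ w with w ≟ᶠ x
    ... | yes refl = subst₂ (λ a j → Walk H a _ j) (sym (lookup∘update x g _))
                       (sym (updateAt-updates x c)) here
    ... | no w≢x   = subst₂ (λ a j → Walk H a _ j) (sym (lookup∘update′ w≢x g _))
                       (sym (updateAt-minimal w x c w≢x)) (hw w)
    rest-tour : ∃ λ L → Walk (G ≀ H) (g′ , x₂) (f′ , y) L × suc L ≤ length xs + sum c′
    rest-tour = tour rest (λ w w∉xs → lookup-fix g f′ x w λ w≢x → off w λ
                  { (here w≡x) → w≢x w≡x ; (there w∈xs) → w∉xs w∈xs }) c′ hw′
    L : ℕ
    L = proj₁ rest-tour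
    W : Walk (G ≀ H) (g′ , x₂) (f′ , y) L
    W = proj₁ (proj₂ rest-tour)
    bound : suc (c x + suc L) ≤ suc (length xs) + sum c
    bound = s≤s (begin
      c x + suc L                  ≤⟨ +-monoʳ-≤ (c x) (proj₂ (proj₂ rest-tour)) ⟩
      c x + (length xs + sum c′)   ≡⟨ +-comm (c x) _ ⟩
      (length xs + sum c′) + c x   ≡⟨ +-assoc (length xs) _ _ ⟩
      length xs + (sum c′ + c x)   ≡⟨ cong (length xs +_) c′-spent ⟩
      length xs + sum c            ∎)
      where
      open ≤-Reasoning
      c′-spent : sum c′ + c x ≡ sum c
      c′-spent = trans (sum-updateAt c x (const 0)) (+-identityʳ _)

  -- A walk in G ≀ H is shadowed by a walk in G (the positions visited) and, at every
  -- coordinate, by a walk in H (the moves made there).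
  record Trace (g : Config) (x : Fin n) (f′ : Config) (v : Fin n) (L : ℕ) : Set where
    field
      route         : List (Fin n)
      route-walk    : IsWalkList G x route v
      moves         : Vector ℕ n
      coord-walk    : ∀ w → Walk H (lookup g w) (lookup f′ w) (moves w)
      length-eq     : suc L ≡ length route + sum moves
      changed∈route : ∀ w → lookup g w ≢ lookup f′ w → w ∈ route

  trace : ∀ {g x f′ v L} → Walk (G ≀ H) (g , x) (f′ , v) L → Trace g x f′ v L
  trace {x = x} here = record
    { route         = x ∷ []
    ; route-walk    = single
    ; moves         = const 0
    ; coord-walk    = λ _ → here
    ; length-eq     = cong suc (sym (trans (sum-const n 0) (*-zeroʳ n)))
    ; changed∈route = λ _ g≢g → ⊥-elim (g≢g refl)
    }
  trace {g} {x} {f′} (step {w = g₁ , _} (inj₁ (refl , agree , a~a₁)) rest) = record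
    { route         = route
    ; route-walk    = route-walk
    ; moves         = updateAt moves x suc
    ; coord-walk    = coord-walk′
    ; length-eq     = trans (cong suc length-eq)
                        (sym (trans (cong (length route +_) (sum-updateAt-suc moves x)) (+-suc _ _)))
    ; changed∈route = changed∈route′
    }
    where
    open Trace (trace rest)
    coord-walk′ : ∀ w → Walk H (lookup g w) (lookup f′ w) (updateAt moves x suc w)
    coord-walk′ w with w ≟ᶠ x
    ... | yes refl = subst (Walk H _ _) (sym (updateAt-updates x moves)) (step a~a₁ (coord-walk x))
    ... | no w≢x   = subst₂ (λ a j → Walk H a _ j) (sym (agree w w≢x))
                       (sym (updateAt-minimal w x moves w≢x)) (coord-walk w)
    changed∈route′ : ∀ w → lookup g w ≢ lookup f′ w → w ∈ route
    changed∈route′ w changed with w ≟ᶠ x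
    ... | yes refl = first∈ route-walk
    ... | no w≢x   = changed∈route w (changed ∘ trans (agree w w≢x))
  trace (step (inj₂ (refl , x~x₁)) rest) = record
    { route         = _ ∷ route
    ; route-walk    = cons x~x₁ route-walk
    ; moves         = moves
    ; coord-walk    = coord-walk
    ; length-eq     = cong suc length-eq
    ; changed∈route = λ w changed → there (changed∈route w changed)
    }
    where open Trace (trace rest)

  trace-length-≥ : 2 ≤ n → ∀ {g x f′ L} (T : Trace g x f′ x L) → (∀ w → lookup g w ≢ lookup f′ w) →
    n + sum (Trace.moves T) ≤ L
  trace-length-≥ 2≤n T all-changed = ≤-pred (begin
    suc n + sum moves          ≤⟨ +-monoˡ-≤ (sum moves) (closed-spanning-length 2≤n route-walk spans) ⟩
    length route + sum moves   ≡⟨ length-eq ⟨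
    suc _                      ∎)
    where
    open Trace T
    open ≤-Reasoning
    spans : ∀ w → w ∈ route
    spans w = changed∈route w (all-changed w)

  module _ (2≤n : 2 ≤ n) (G-connected : Connected G) (G-hamiltonian : HamiltonConnected G)
           {g f′ : Config} (c : Vector ℕ n) (hw : ∀ w → Walk H (lookup g w) (lookup f′ w) (c w)) where

    hamiltonian-tour : ∀ {u v} → u ≢ v → ∃ λ L → Walk (G ≀ H) (g , u) (f′ , v) L × suc L ≤ n + sum c
    hamiltonian-tour {u} {v} u≢v =
      let p , p-walk , p-unique , p-spans = G-hamiltonian u v u≢v
          L , W , bound = tour p-walk (λ w w∉p → ⊥-elim (w∉p (p-spans w))) c hw
      in L , W , ≤-trans bound (+-monoˡ-≤ (sum c) (unique⇒length≤ p-unique))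

    short-walk : ∀ u v → ∃ λ L → Walk (G ≀ H) (g , u) (f′ , v) L × L ≤ n + sum c
    short-walk u v with u ≟ᶠ v
    ... | no u≢v = let L , W , bound = hamiltonian-tour u≢v in L , W , ≤-trans (n≤1+n L) bound
    ... | yes refl =
      let y , u~y = has-neighbour G-connected 2≤n u
          L , W , bound = hamiltonian-tour (adj⇒≢ {X = G} u~y)
      in L + 1 , W ++ᵂ step (inj₂ (refl , adj-sym G u~y)) here , subst (_≤ n + sum c) (+-comm 1 L) bound

  opposite-Dist : 2 ≤ n → Connected G → HamiltonConnected G → ∀ {f f′ : Config} {x D} → 1 ≤ D →
    (∀ w → Dist H (lookup f w) (lookup f′ w) D) → Dist (G ≀ H) (f , x) (f′ , x) (n * suc D)
  opposite-Dist 2≤n G-connected G-hamiltonian {f} {f′} {x} {D} 1≤D dist =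
    subst (Walk (G ≀ H) _ _) L≡nD W , lower
    where
    open ≤-Reasoning
    lower : ∀ j → Walk (G ≀ H) (f , x) (f′ , x) j → n * suc D ≤ j
    lower j W′ = begin
      n * suc D             ≡⟨ n+sum-const n D ⟨
      n + sum {n} (const D) ≤⟨ +-monoʳ-≤ n (sum-mono-≤ λ w → proj₂ (dist w) _ (coord-walk w)) ⟩
      n + sum moves         ≤⟨ trace-length-≥ 2≤n T (λ w → Dist-pos⇒≢ (dist w) 1≤D) ⟩
      j                     ∎
      where
      T : Trace f x f′ x j
      T = trace W′
      open Trace T
    upper : ∃ λ L → Walk (G ≀ H) (f , x) (f′ , x) L × L ≤ n + sum {n} (const D)
    upper = short-walk 2≤n G-connected G-hamiltonian {f} {f′} (const D) (proj₁ ∘ dist) x x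
    W : Walk (G ≀ H) (f , x) (f′ , x) (proj₁ upper)
    W = proj₁ (proj₂ upper)
    L≡nD : proj₁ upper ≡ n * suc D
    L≡nD = ≤-antisym (≤-trans (proj₂ (proj₂ upper)) (≤-reflexive (n+sum-const n D))) (lower _ W)

module Antipodality {n m} (G : Graph (Fin n)) (H : Graph (Fin m)) (2≤n : 2 ≤ n) (2≤m : 2 ≤ m)
         (G-connected : Connected G) (H-connected : Connected H) (G-hamiltonian : HamiltonConnected G) where

  open Wreath G H

  -- Adjacency in H is not decidable, so shortest walks in H exist only classically;
  -- this suffices for goals that are decidable.
  withDistances : ∀ {P : Set} → Dec P → (DistanceTable H → P) → P
  withDistances P? k = decidable-stable P? (¬¬-map k (¬¬-distanceTable H-connected))

  Diam-pos : ∀ {D} → Diam H D → 1 ≤ D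
  Diam-pos {D} (_ , bounded) = withDistances (1 ≤? D) λ τ →
    let open DistanceTable τ
        a , b , a≢b = two-vertices 2≤m
    in ≤-trans (walk-length-pos (proj₁ (δ-dist a b)) a≢b) (bounded a b _ (δ-dist a b))

  module Distances (τ : DistanceTable H) where
    open DistanceTable τ

    gap : Config → Config → Vector ℕ n
    gap f f′ w = δ (lookup f w) (lookup f′ w)

    sum-gap≤ : ∀ {D} → Diam H D → ∀ f f′ → sum (gap f f′) ≤ n * D
    sum-gap≤ {D} (_ , bounded) f f′ =
      ≤-trans (sum-mono-≤ {t = gap f f′} {t′ = const D} λ _ → bounded _ _ _ (δ-dist _ _))
              (≤-reflexive (sum-const n D))

    shortest : ∀ f f′ w → Walk H (lookup f w) (lookup f′ w) (gap f f′ w)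
    shortest _ _ _ = proj₁ (δ-dist _ _)

    H-diameter : Σ ℕ (Diam H)
    H-diameter = diameter (proj₁ (two-vertices 2≤m))

    dist≤n+gap : ∀ {f f′ u v k} → Dist (G ≀ H) (f , u) (f′ , v) k → k ≤ n + sum (gap f f′)
    dist≤n+gap {f} {f′} {u} {v} (_ , minimal) =
      let L , W , bound = short-walk 2≤n G-connected G-hamiltonian {f} {f′} (gap f f′) (shortest f f′) u v
      in ≤-trans (minimal L W) bound

    dist<n+gap : ∀ {f f′ u v k} → u ≢ v → Dist (G ≀ H) (f , u) (f′ , v) k → suc k ≤ n + sum (gap f f′)
    dist<n+gap {f} {f′} u≢v (_ , minimal) =
      let L , W , bound =
            hamiltonian-tour 2≤n G-connected G-hamiltonian {f} {f′} (gap f f′) (shortest f f′) u≢v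
      in ≤-trans (s≤s (minimal L W)) bound

  wreath-Diam : ∀ D → Diam H D → Diam (G ≀ H) (n * suc D)
  wreath-Diam D dH@((a , b , a-b) , _) =
    ( (replicate n a , x₀) , (replicate n b , x₀)
    , opposite-Dist 2≤n G-connected G-hamiltonian (Diam-pos dH) dist)
    , bounded
    where
    x₀ : Fin n
    x₀ = proj₁ (two-vertices 2≤n)
    dist : ∀ w → Dist H (lookup (replicate n a) w) (lookup (replicate n b) w) D
    dist w = subst₂ (λ a′ b′ → Dist H a′ b′ D) (sym (lookup-replicate w a)) (sym (lookup-replicate w b)) a-b
    bounded : ∀ p q k → Dist (G ≀ H) p q k → k ≤ n * suc D
    bounded (f , _) (f′ , _) k d = withDistances (k ≤? n * suc D) λ τ → let open Distances τ in begin
      k                        ≤⟨ dist≤n+gap d ⟩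
      n + sum (gap f f′)       ≤⟨ +-monoʳ-≤ n (sum-gap≤ dH f f′) ⟩
      n + n * D                ≡⟨ *-suc n D ⟨
      n * suc D                ∎
      where open ≤-Reasoning

  module _ (τ : DistanceTable H) {f f′ : Config} {u v N}
           (dN : Diam (G ≀ H) N) (d : Dist (G ≀ H) (f , u) (f′ , v) N) where
    open DistanceTable τ
    open Distances τ
    open ≤-Reasoning

    private
      D : ℕ
      D = proj₁ H-diameter
      dH : Diam H D
      dH = proj₂ H-diameter

      N≡ : N ≡ n + n * D
      N≡ = trans (Diam-unique dN (wreath-Diam D dH)) (*-suc n D)

    antipodal-same-base : u ≡ v
    antipodal-same-base with u ≟ᶠ v
    ... | yes u≡v = u≡v
    ... | no u≢v  = ⊥-elim (1+n≰n (begin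
      suc N                ≤⟨ dist<n+gap u≢v d ⟩
      n + sum (gap f f′)   ≤⟨ +-monoʳ-≤ n (sum-gap≤ dH f f′) ⟩
      n + n * D            ≡⟨ N≡ ⟨
      N                    ∎))

    antipodal-coordinates : u ≡ v → (T : Trace f u f′ v N) → ∀ w → Trace.moves T w ≡ D × gap f f′ w ≡ D
    antipodal-coordinates refl T w = moves≡D w , gap≡D w
      where
      open Trace T
      gap≥ : n * D ≤ sum (gap f f′)
      gap≥ = +-cancelˡ-≤ n _ _ (subst (_≤ n + sum (gap f f′)) N≡ (dist≤n+gap d))
      gap≡D : ∀ w → gap f f′ w ≡ D
      gap≡D = pointwise≤∧sum≥⇒≡ (λ _ → proj₂ dH _ _ _ (δ-dist _ _))
                (≤-trans (≤-reflexive (sum-const n D)) gap≥)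
      changed : ∀ w → lookup f w ≢ lookup f′ w
      changed w = Dist-pos⇒≢ (subst (Dist H _ _) (gap≡D w) (δ-dist _ _)) (Diam-pos dH)
      moves≤ : sum moves ≤ n * D
      moves≤ = +-cancelˡ-≤ n _ _ (subst (n + sum moves ≤_) N≡ (trace-length-≥ 2≤n T changed))
      moves≡D : ∀ w → moves w ≡ D
      moves≡D w = sym (pointwise≤∧sum≥⇒≡ {t = const D}
        (λ w → subst (_≤ moves w) (gap≡D w) (δ-min (coord-walk w)))
        (≤-trans moves≤ (≤-reflexive (sym (sum-const n D)))) w)

  antipodal⇒ : ∀ p q → Antipodal (G ≀ H) p q → DirProd (DirPow (Antipodal H) n) (O n) p q
  antipodal⇒ (f , u) (f′ , v) (N , dN , d) = (λ w → moves w , coord-Diam w , coord-Dist w) , same-base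
    where
    open Trace (trace (proj₁ d))
    same-base : u ≡ v
    same-base = withDistances (u ≟ᶠ v) λ τ → antipodal-same-base τ dN d
    rigid : ∀ τ w → let D = proj₁ (Distances.H-diameter τ) in moves w ≡ D × Distances.gap τ f f′ w ≡ D
    rigid τ = antipodal-coordinates τ dN d same-base (trace (proj₁ d))
    coord-Dist : ∀ w → Dist H (lookup f w) (lookup f′ w) (moves w)
    coord-Dist w = coord-walk w , λ j W → withDistances (moves w ≤? j) λ τ →
      let moves≡D , gap≡D = rigid τ w
      in subst (_≤ j) (trans gap≡D (sym moves≡D)) (DistanceTable.δ-min τ W)
    coord-Diam : ∀ w → Diam H (moves w)
    coord-Diam w = (lookup f w , lookup f′ w , coord-Dist w) , λ a b k dk →
      withDistances (k ≤? moves w) λ τ →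
        subst (k ≤_) (sym (proj₁ (rigid τ w))) (proj₂ (proj₂ (Distances.H-diameter τ)) a b k dk)

  antipodal⇐ : ∀ p q → DirProd (DirPow (Antipodal H) n) (O n) p q → Antipodal (G ≀ H) p q
  antipodal⇐ (f , u) (f′ , .u) (antipodal , refl) =
    n * suc D , wreath-Diam D dH , opposite-Dist 2≤n G-connected G-hamiltonian (Diam-pos dH) dist
    where
    -- u serves only as some coordinate: all coordinates see the same diameter of H.
    D : ℕ
    D = proj₁ (antipodal u)
    dH : Diam H D
    dH = proj₁ (proj₂ (antipodal u))
    dist : ∀ w → Dist H (lookup f w) (lookup f′ w) D
    dist w = let _ , dHw , d = antipodal w in subst (Dist H _ _) (Diam-unique dHw dH) d

corollary4p20 : ∀ {n m} (G : Graph (Fin n)) (H : Graph (Fin m)) →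
    2 ≤ n → 2 ≤ m → Connected G → Connected H → HamiltonConnected G →
    (∀ u v → Antipodal (G ≀ H) u v ⇔ DirProd (DirPow (Antipodal H) n) (O n) u v)
    × (∀ D → Diam H D → Diam (G ≀ H) (n * suc D))
corollary4p20 G H 2≤n 2≤m G-connected H-connected G-hamiltonian =
  (λ p q → mk⇔ (antipodal⇒ p q) (antipodal⇐ p q)) , wreath-Diam
  where open Antipodality G H 2≤n 2≤m G-connected H-connected G-hamiltonian
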